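{- Let $b\ge 2$, and let $v_1=(0)$ (the root of $T_b(\infty)$) and $v_{m+1}$ the last son of $v_m$ for $m\ge1$, so that $v_1,v_2,\dots$ is the rightmost branch of $T_b(\infty)$. Then for every $i\ge1$: $v_i$ is the canonical base-$b$ representation of $i-1$ (i.e. the unique $b$-ary partition of $i-1$ all of whose components lie in $\{0,\dots,b-1\}$); $v_i$ has exactly $c_b(i)+1$ sons, the last of which is $v_{i+1}$; and for $1\le j\le c_b(i)$, the $j$-th son of $v_i$ is the root of an $X_{b,j}$ subtree of $T_b(\infty)$.
   Context: A $b$-ary partition of $n\ge0$ is a sequence $p=(p_0,p_1,\dots)$ of non-negative integers, finitely many nonzero, with $\sum_j p_jb^j=n$. For such $p$, let $l(p)$ be the largest $l\ge0$ with $p_0=\dots=p_{l-1}=b-1$, and for $0\le i\le l(p)$ let $\mathrm{inc}_i(p)=(0,\dots,0,p_i+1,p_{i+1},\dots)$ ($i$ leading zeros). The ordered rooted tree $T_b(\infty)$ has as nodes all $b$-ary partitions of all $n\ge0$, root $(0,0,\dots)$, and each node $p$ has exactly $l(p)+1$ ordered sons, the $(i+1)$-th being $\mathrm{inc}_i(p)$. For a node $p$, its rightmost branch is $w_1=p$, $w_{m+1}=$ last son of $w_m$. For $m\ge1$, $c_b(m)$ is the largest $k$ such that $b^k$ divides $m$. For $k\ge1$, $X_{b,k}$ is the ordered rooted tree (unique up to isomorphism, being determined level by level) whose rightmost branch $w_1,w_2,\dots$ satisfies: for each $1\le i\le b^{k-1}$, $w_i$ has exactly $c_b(i)+1$ sons,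 the last being $w_{i+1}$, and for $1\le l\le c_b(i)$ the subtree rooted at its $l$-th son is isomorphic to $X_{b,l}$; and the subtree rooted at $w_{b^{k-1}+1}$ is isomorphic to $X_{b,k}$. A node $p$ of $T_b(\infty)$ is the root of an $X_{b,k}$ subtree if the subtree consisting of $p$ and all its descendants is isomorphic, as an ordered rooted tree, to $X_{b,k}$. -}

module Defs where

open import Data.Nat using (ℕ; zero; suc; _+_; _*_; _∸_; _^_; _≟_; _<?_; _≤?_)
open import Data.Nat.Divisibility using (_∣?_)
open import Data.Bool using (Bool; true; false)
open import Data.List using (List; []; _∷_; _++_; replicate; drop; map; upTo)
open import Data.Maybe using (Maybe; just; nothing; is-just)
open import Relation.Nullary using (yes; no)

-- b-ary partitions.  A partition p = (p₀, p₁, …) is represented by a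
-- finite list [p₀, …, p_{r-1}]; all components beyond the list are 0.

Partition : Set
Partition = List ℕ

comp : Partition → ℕ → ℕ
comp []       _       = 0
comp (x ∷ p)  zero    = x
comp (x ∷ p)  (suc j) = comp p j

value : ℕ → Partition → ℕ
value b []      = 0
value b (x ∷ p) = x + b * value b p

lead : ℕ → Partition → ℕ
lead b []      = 0
lead b (x ∷ p) with x ≟ b ∸ 1
... | yes _ = suc (lead b p)
... | no  _ = 0

inc : ℕ → Partition → Partition
inc i p = replicate i 0 ++ (suc (comp p i) ∷ drop (suc i) p)

sons : ℕ → Partition → List Partition
sons b p = map (λ i → inc i p) (upTo (suc (lead b p)))

root : Partition
root = []

lastSon : ℕ → Partition → Partition
lastSon b p = inc (lead b p) p

-- v₁ = root, v_{m+1} = last son of v_m   (v 0 is unused; set to root)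
v : ℕ → ℕ → Partition
v b zero          = root
v b (suc zero)    = root
v b (suc (suc m)) = lastSon b (v b (suc m))

nth : {A : Set} → List A → ℕ → Maybe A
nth []       _       = nothing
nth (x ∷ xs) zero    = just x
nth (x ∷ xs) (suc j) = nth xs j

-- c_b(m): the largest k such that b^k ∣ m.  For b ≥ 2 and m ≥ 1 any
-- such k satisfies k < m, so searching k ∈ {0,…,m} is exhaustive.

cbSearch : ℕ → ℕ → ℕ → ℕ
cbSearch b m zero    = 0
cbSearch b m (suc k) with b ^ suc k ∣? m
... | yes _ = suc k
... | no  _ = cbSearch b m k

c : ℕ → ℕ → ℕ
c b m = cbSearch b m m

-- Ordered rooted trees up to isomorphism are identified with their
-- (Ulam–Harris) address sets: an address is a list of 0-based son
-- indices, read from the root downward.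

walk : ℕ → Partition → List ℕ → Maybe Partition
walk b p []      = just p
walk b p (j ∷ a) with j ≤? lead b p
... | yes _ = walk b (inc j p) a
... | no  _ = nothing

-- Address set of X_{b,k}.  inX b k i a decides whether address a
-- (relative to the node w_i, 1 ≤ i ≤ b^{k-1}, of the rightmost branch
-- of X_{b,k}) belongs to the tree.  w_i has c_b(i)+1 sons; its
-- (l)-th son for 1 ≤ l ≤ c_b(i) (0-based index l-1) roots a copy of
-- X_{b,l}; its last son (0-based index c_b(i)) is w_{i+1}, and
-- w_{b^{k-1}+1} roots a copy of X_{b,k}, i.e. plays the role of w_1.
nextPos : ℕ → ℕ → ℕ → ℕ
nextPos b k i with i ≟ b ^ (k ∸ 1)
... | yes _ = 1
... | no  _ = suc i

inX : ℕ → ℕ → ℕ → List ℕ → Bool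
inX b k i []      = true
inX b k i (j ∷ a) with j <? c b i | j ≟ c b i
... | yes _ | _     = inX b (suc j) 1 a
... | no  _ | yes _ = inX b k (nextPos b k i) a
... | no  _ | no  _ = false

IsXRoot : ℕ → ℕ → Partition → Set
IsXRoot b k p = (a : List ℕ) → is-just (walk b p a) ≡ inX b k 1 a
  where open import Relation.Binary.PropositionalEquality using (_≡_)

module Submission where

-- Following last sons is counting in base b: inc_{l(p)} adds 1 to p and
-- propagates the carry through the l(p) trailing digits b − 1.  Hence v_i
-- is i − 1 written in base b, and v_i has l(v_i) + 1 sons, where l(v_i) is
-- the number of trailing digits b − 1 of i − 1, i.e. c_b(i).
--
-- For the X-subtrees, call p an m-carry if its components below m are
-- digits, forming the number r, and its m-th component is at least b.  The
-- subtree of such p is the subtree of X_{b,m+1} at w_{r+1}: as for v_{r+1},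
-- p has c_b(r + 1) + 1 sons; its j-th son, j < l(p), is a fresh j-carry
-- (zeros below a component b), i.e. a copy of X_{b,j+1}; and its last son
-- is an m-carry with number r + 1, unless r + 1 = b^m, when it is the fresh
-- m-carry inc_m(p), matching w_{b^m + 1} ≅ w_1.  A son inc_j(p) of any node
-- with j < l(p) is a fresh j-carry, which gives the last claim.

open import Defs
open import Data.Nat
  using (ℕ; zero; suc; _+_; _*_; _∸_; _^_; _≤_; _<_; z≤n; s≤s; z<s; _≟_)
open import Data.Nat.Properties
open import Data.Nat.Divisibility
open import Data.List using ([]; _∷_; length; last; applyUpTo)
open import Data.List.Properties using (length-applyUpTo; map-upTo)
open import Data.Maybe using (just; nothing; is-just)
open import Data.Bool using (false)
open import Data.Product using (_×_; _,_; ∃; ∃-syntax)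
open import Data.Sum using (inj₁; inj₂)
open import Function using (_∘_)
open import Relation.Nullary using (yes; no; contradiction)
open import Relation.Binary using (tri<; tri≈; tri>)
open import Relation.Binary.PropositionalEquality
open ≡-Reasoning

comp-inc-< : ∀ {j t} p → t < j → comp (inc j p) t ≡ 0
comp-inc-< {suc j} {zero}  p       _         = refl
comp-inc-< {suc j} {suc t} []      (s≤s t<j) = comp-inc-< [] t<j
comp-inc-< {suc j} {suc t} (_ ∷ p) (s≤s t<j) = comp-inc-< p t<j

comp-inc-≡ : ∀ j p → comp (inc j p) j ≡ suc (comp p j)
comp-inc-≡ zero    p       = refl
comp-inc-≡ (suc j) []      = comp-inc-≡ j []
comp-inc-≡ (suc j) (_ ∷ p) = comp-inc-≡ j p

comp-inc-> : ∀ {j t} p → j < t → comp (inc j p) t ≡ comp p t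
comp-inc-> {zero}  {suc t} []      _         = refl
comp-inc-> {zero}  {suc t} (_ ∷ p) _         = refl
comp-inc-> {suc j} {suc t} []      (s≤s j<t) = comp-inc-> [] j<t
comp-inc-> {suc j} {suc t} (_ ∷ p) (s≤s j<t) = comp-inc-> p j<t

comp-length : ∀ p → comp p (length p) ≡ 0
comp-length []      = refl
comp-length (_ ∷ p) = comp-length p

comp-<lead : ∀ b p {t} → t < lead b p → comp p t ≡ b ∸ 1
comp-<lead b [] ()
comp-<lead b (x ∷ p) {t} t<l with x ≟ b ∸ 1
comp-<lead b (x ∷ p) {zero}  _         | yes x≡ = x≡
comp-<lead b (x ∷ p) {suc t} (s≤s t<l) | yes _  = comp-<lead b p t<l
comp-<lead b (x ∷ p) {t}     ()        | no _

lead-≤ : ∀ b p {t} → comp p t ≢ b ∸ 1 → lead b p ≤ t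
lead-≤ b [] _ = z≤n
lead-≤ b (x ∷ p) {t} p≢ with x ≟ b ∸ 1
lead-≤ b (x ∷ p) {zero}  x≢ | yes x≡ = contradiction x≡ x≢
lead-≤ b (x ∷ p) {suc t} p≢ | yes _  = s≤s (lead-≤ b p p≢)
lead-≤ b (x ∷ p) {t}     _  | no _   = z≤n

lowValue : ℕ → ℕ → Partition → ℕ
lowValue b zero    _       = 0
lowValue b (suc m) []      = 0
lowValue b (suc m) (x ∷ p) = x + b * lowValue b m p

lowValue-[] : ∀ b m → lowValue b m [] ≡ 0
lowValue-[] b zero    = refl
lowValue-[] b (suc m) = refl

lowValue-length : ∀ b p → lowValue b (length p) p ≡ value b p
lowValue-length b []      = refl
lowValue-length b (x ∷ p) = cong (λ r → x + b * r) (lowValue-length b p)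

lowValue-inc-zeros : ∀ b j p → lowValue b j (inc j p) ≡ 0
lowValue-inc-zeros b zero    p       = refl
lowValue-inc-zeros b (suc j) []      = trans (cong (b *_) (lowValue-inc-zeros b j [])) (*-zeroʳ b)
lowValue-inc-zeros b (suc j) (_ ∷ p) = trans (cong (b *_) (lowValue-inc-zeros b j p)) (*-zeroʳ b)

^-monoʳ-∣ : ∀ x {m n} → m ≤ n → x ^ m ∣ x ^ n
^-monoʳ-∣ x {m} {n} m≤n = divides (x ^ (n ∸ m)) (begin
  x ^ n               ≡⟨ cong (x ^_) (m+[n∸m]≡n m≤n) ⟨
  x ^ (m + (n ∸ m))   ≡⟨ ^-distribˡ-+-* x m (n ∸ m) ⟩
  x ^ m * x ^ (n ∸ m) ≡⟨ *-comm (x ^ m) _ ⟩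
  x ^ (n ∸ m) * x ^ m ∎)

IsXRootAt : ℕ → ℕ → ℕ → Partition → Set
IsXRootAt b k i p = ∀ a → is-just (walk b p a) ≡ inX b k i a

walk-≤ : ∀ b p a {j} → j ≤ lead b p → walk b p (j ∷ a) ≡ walk b (inc j p) a
walk-≤ b p a {j} j≤l with j ≤? lead b p
... | yes _   = refl
... | no  j≰l = contradiction j≤l j≰l

walk-> : ∀ b p a {j} → lead b p < j → walk b p (j ∷ a) ≡ nothing
walk-> b p a {j} l<j with j ≤? lead b p
... | yes j≤l = contradiction j≤l (<⇒≱ l<j)
... | no  _   = refl

inX-< : ∀ b k i a {j} → j < c b i → inX b k i (j ∷ a) ≡ inX b (suc j) 1 a
inX-< b k i a {j} j<c with j <? c b i
... | yes _   = refl
... | no  j≮c = contradiction j<c j≮c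

inX-≡ : ∀ b k i a {j} → j ≡ c b i → inX b k i (j ∷ a) ≡ inX b k (nextPos b k i) a
inX-≡ b k i a {j} j≡c with j <? c b i | j ≟ c b i
... | yes j<c | _       = contradiction j≡c (<⇒≢ j<c)
... | no  _   | yes _   = refl
... | no  _   | no  j≢c = contradiction j≡c j≢c

inX-> : ∀ b k i a {j} → c b i < j → inX b k i (j ∷ a) ≡ false
inX-> b k i a {j} c<j with j <? c b i | j ≟ c b i
... | yes j<c | _       = contradiction j<c (<⇒≯ c<j)
... | no  _   | yes j≡c = contradiction (sym j≡c) (<⇒≢ c<j)
... | no  _   | no  _   = refl

nextPos-≡ : ∀ b k {i} → i ≡ b ^ (k ∸ 1) → nextPos b k i ≡ 1
nextPos-≡ b k {i} i≡ with i ≟ b ^ (k ∸ 1)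
... | yes _  = refl
... | no  i≢ = contradiction i≡ i≢

nextPos-≢ : ∀ b k {i} → i ≢ b ^ (k ∸ 1) → nextPos b k i ≡ suc i
nextPos-≢ b k {i} i≢ with i ≟ b ^ (k ∸ 1)
... | yes i≡ = contradiction i≡ i≢
... | no  _  = refl

last-applyUpTo : ∀ {A : Set} (f : ℕ → A) n → last (applyUpTo f (suc n)) ≡ just (f n)
last-applyUpTo f zero    = refl
last-applyUpTo f (suc n) = last-applyUpTo (f ∘ suc) n

nth-applyUpTo : ∀ {A : Set} (f : ℕ → A) {n j} → j < n → nth (applyUpTo f n) j ≡ just (f j)
nth-applyUpTo f {suc n} {zero}  _         = refl
nth-applyUpTo f {suc n} {suc j} (s≤s j<n) = nth-applyUpTo (f ∘ suc) j<n

sons≡applyUpTo : ∀ b p → sons b p ≡ applyUpTo (λ j → inc j p) (suc (lead b p))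
sons≡applyUpTo b p = map-upTo (λ j → inc j p) (suc (lead b p))

length-sons : ∀ b p → length (sons b p) ≡ suc (lead b p)
length-sons b p = trans (cong length (sons≡applyUpTo b p)) (length-applyUpTo (λ j → inc j p) _)

last-sons : ∀ b p → last (sons b p) ≡ just (lastSon b p)
last-sons b p = trans (cong last (sons≡applyUpTo b p)) (last-applyUpTo (λ j → inc j p) (lead b p))

nth-sons : ∀ b p {j} → j ≤ lead b p → nth (sons b p) j ≡ just (inc j p)
nth-sons b p {j} j≤l = trans (cong (λ s → nth s j) (sons≡applyUpTo b p)) (nth-applyUpTo (λ j → inc j p) (s≤s j≤l))

module Radix (d : ℕ) where

  B : ℕ
  B = 2 + d

  Digits : Partition → Set
  Digits p = ∀ t → comp p t < B

  suc-digit : ∀ {x} → x < B → x ≢ suc d → suc x < B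
  suc-digit x<B x≢ = ≤∧≢⇒< x<B (x≢ ∘ suc-injective)

  comp-lead≢ : ∀ p → comp p (lead B p) ≢ suc d
  comp-lead≢ [] ()
  comp-lead≢ (x ∷ p) with x ≟ suc d
  ... | yes _  = comp-lead≢ p
  ... | no  x≢ = x≢

  n<B^n : ∀ n → n < B ^ n
  n<B^n zero    = z<s
  n<B^n (suc n) =
    ≤-trans (s≤s (n<B^n n))
      (≤-trans (m<m+n (B ^ n) (m^n>0 B n))
        (+-monoʳ-≤ (B ^ n) (m≤m+n (B ^ n) (d * B ^ n))))

  value-lastSon : ∀ p → value B (lastSon B p) ≡ suc (value B p)
  value-lastSon [] = cong suc (*-zeroʳ B)
  value-lastSon (x ∷ p) with x ≟ suc d
  ... | no  _    = refl
  ... | yes refl = begin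
    B * value B (lastSon B p) ≡⟨ cong (B *_) (value-lastSon p) ⟩
    B * suc (value B p)       ≡⟨ *-suc B _ ⟩
    B + B * value B p         ∎

  Digits-lastSon : ∀ p → Digits p → Digits (lastSon B p)
  Digits-lastSon [] _ zero    = s≤s z<s
  Digits-lastSon [] _ (suc t) = z<s
  Digits-lastSon (x ∷ p) ds t with x ≟ suc d
  Digits-lastSon (x ∷ p) ds zero    | yes _  = z<s
  Digits-lastSon (x ∷ p) ds (suc t) | yes _  = Digits-lastSon p (ds ∘ suc) t
  Digits-lastSon (x ∷ p) ds zero    | no  x≢ = suc-digit (ds 0) x≢
  Digits-lastSon (x ∷ p) ds (suc t) | no  _  = ds (suc t)

  v-canonical : ∀ n → Digits (v B (suc n)) × value B (v B (suc n)) ≡ n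
  v-canonical zero    = (λ _ → z<s) , refl
  v-canonical (suc n) with v-canonical n
  ... | ds , val = Digits-lastSon (v B (suc n)) ds , trans (value-lastSon (v B (suc n))) (cong suc val)

  lowValue<B^m : ∀ m p → (∀ {t} → t < m → comp p t < B) → lowValue B m p < B ^ m
  lowValue<B^m zero    p       _  = z<s
  lowValue<B^m (suc m) []      _  = m^n>0 B (suc m)
  lowValue<B^m (suc m) (x ∷ p) ds =
    ≤-trans (+-monoˡ-≤ (B * lowValue B m p) (ds z<s))
      (≤-trans (≤-reflexive (sym (*-suc B _)))
        (*-monoʳ-≤ B (lowValue<B^m m p (λ t<m → ds (s≤s t<m)))))

  lowValue-full : ∀ m p → m ≤ lead B p → suc (lowValue B m p) ≡ B ^ m
  lowValue-full zero    p       _ = refl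
  lowValue-full (suc m) []      ()
  lowValue-full (suc m) (x ∷ p) m≤l with x ≟ suc d
  lowValue-full (suc m) (x ∷ p) (s≤s m≤l) | yes refl = begin
    B + B * lowValue B m p   ≡⟨ *-suc B _ ⟨
    B * suc (lowValue B m p) ≡⟨ cong (B *_) (lowValue-full m p m≤l) ⟩
    B * B ^ m                ∎
  lowValue-full (suc m) (x ∷ p) () | no _

  lowValue-lastSon : ∀ {m} p → lead B p < m → lowValue B m (lastSon B p) ≡ suc (lowValue B m p)
  lowValue-lastSon {suc m} [] _ = cong suc (trans (cong (B *_) (lowValue-[] B m)) (*-zeroʳ B))
  lowValue-lastSon {suc m} (x ∷ p) l<m with x ≟ suc d
  lowValue-lastSon {suc m} (x ∷ p) (s≤s l<m) | yes refl = begin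
    B * lowValue B m (lastSon B p) ≡⟨ cong (B *_) (lowValue-lastSon p l<m) ⟩
    B * suc (lowValue B m p)       ≡⟨ *-suc B _ ⟩
    B + B * lowValue B m p         ∎
  lowValue-lastSon {suc m} (x ∷ p) _ | no _ = refl

  cbSearch-≡ : ∀ {M l} K → l ≤ K → B ^ l ∣ M → (∀ {k} → l < k → B ^ k ∤ M) →
               cbSearch B M K ≡ l
  cbSearch-≡ zero z≤n _ _ = refl
  cbSearch-≡ {M} (suc K) l≤K B^l∣M higher∤M with B ^ suc K ∣? M | m≤n⇒m<n∨m≡n l≤K
  ... | yes _     | inj₂ refl = refl
  ... | no  B^l∤M | inj₂ refl = contradiction B^l∣M B^l∤M
  ... | yes B^K∣M | inj₁ l<K  = contradiction B^K∣M (higher∤M l<K)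
  ... | no  _     | inj₁ l<K  = cbSearch-≡ K (≤-pred l<K) B^l∣M higher∤M

  c-B^l*s : ∀ l s → B ∤ s → c B (B ^ l * s) ≡ l
  c-B^l*s l zero    B∤s = contradiction (B ∣0) B∤s
  c-B^l*s l (suc s) B∤s =
    cbSearch-≡ (B ^ l * suc s) (≤-trans (<⇒≤ (n<B^n l)) (m≤m*n (B ^ l) (suc s)))
      (m∣m*n (suc s)) higher∤
    where
    higher∤ : ∀ {k} → l < k → B ^ k ∤ B ^ l * suc s
    higher∤ l<k B^k∣ = B∤s (*-cancelˡ-∣ (B ^ l) {{m^n≢0 B l}}
      (subst (_∣ B ^ l * suc s) (*-comm B (B ^ l)) (∣-trans (^-monoʳ-∣ B l<k) B^k∣)))

  -- The number below m ends in exactly l(p) digits B − 1, so adding 1 to it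
  -- leaves B^{l(p)} times a number prime to B.
  suc-lowValue-factor : ∀ m p → (∀ {t} → t < m → comp p t < B) → comp p m ≢ suc d →
                        ∃[ s ] B ∤ s × suc (lowValue B m p) ≡ B ^ lead B p * s
  suc-lowValue-factor zero    [] _ _ = 1 , >⇒∤ (s≤s (s≤s z≤n)) , refl
  suc-lowValue-factor (suc m) [] _ _ = 1 , >⇒∤ (s≤s (s≤s z≤n)) , refl
  suc-lowValue-factor zero (x ∷ p) _ x≢ with x ≟ suc d
  ... | yes x≡ = contradiction x≡ x≢
  ... | no  _  = 1 , >⇒∤ (s≤s (s≤s z≤n)) , refl
  suc-lowValue-factor (suc m) (x ∷ p) ds p≢ with x ≟ suc d
  ... | yes refl with suc-lowValue-factor m p (λ t<m → ds (s≤s t<m)) p≢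
  ...   | s , B∤s , eq = s , B∤s , (begin
          B + B * lowValue B m p    ≡⟨ *-suc B _ ⟨
          B * suc (lowValue B m p)  ≡⟨ cong (B *_) eq ⟩
          B * (B ^ lead B p * s)    ≡⟨ *-assoc B (B ^ lead B p) s ⟨
          B * B ^ lead B p * s      ∎)
  suc-lowValue-factor (suc m) (x ∷ p) ds _ | no x≢ =
    suc (x + B * lowValue B m p) , B∤ , sym (*-identityˡ _)
    where
    B∤ : B ∤ suc x + B * lowValue B m p
    B∤ B∣ = >⇒∤ (suc-digit (ds z<s) x≢)
      (∣m+n∣m⇒∣n (subst (B ∣_) (+-comm (suc x) _) B∣) (m∣m*n (lowValue B m p)))

  c-suc-lowValue : ∀ m p → (∀ {t} → t < m → comp p t < B) → comp p m ≢ suc d →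
                   c B (suc (lowValue B m p)) ≡ lead B p
  c-suc-lowValue m p ds p≢ with suc-lowValue-factor m p ds p≢
  ... | s , B∤s , eq = trans (cong (c B) eq) (c-B^l*s (lead B p) s B∤s)

  c-v : ∀ n → c B (suc n) ≡ lead B (v B (suc n))
  c-v n with v-canonical n
  ... | ds , val = begin
    c B (suc n)                         ≡⟨ cong (c B ∘ suc) val ⟨
    c B (suc (value B q))               ≡⟨ cong (c B ∘ suc) (lowValue-length B q) ⟨
    c B (suc (lowValue B (length q) q)) ≡⟨ c-suc-lowValue (length q) q (λ {t} _ → ds t)
                                            (0≢1+n ∘ trans (sym (comp-length q))) ⟩
    lead B q                            ∎
    where q = v B (suc n)

  record Carry (m : ℕ) (p : Partition) : Set where
    field
      digits   : ∀ {t} → t < m → comp p t < B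
      overflow : B ≤ comp p m
  open Carry

  carry≢ : ∀ {m} p → Carry m p → comp p m ≢ suc d
  carry≢ p cp p≡ = 1+n≰n (subst (B ≤_) p≡ (overflow cp))

  overflow-<lead : ∀ {j} p → j < lead B p → B ≤ suc (comp p j)
  overflow-<lead p j<l = ≤-reflexive (cong suc (sym (comp-<lead B p j<l)))

  carry-inc : ∀ {j} p → B ≤ suc (comp p j) → Carry j (inc j p)
  carry-inc {j} p ov = record
    { digits   = λ t<j → subst (_< B) (sym (comp-inc-< p t<j)) z<s
    ; overflow = subst (B ≤_) (sym (comp-inc-≡ j p)) ov
    }

  carry-lastSon : ∀ {m} p → Carry m p → lead B p < m → Carry m (lastSon B p)
  carry-lastSon {m} p cp l<m = record
    { digits   = digits′
    ; overflow = subst (B ≤_) (sym (comp-inc-> p l<m)) (overflow cp)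
    }
    where
    digits′ : ∀ {t} → t < m → comp (lastSon B p) t < B
    digits′ {t} t<m with <-cmp t (lead B p)
    ... | tri< t<l _ _ = subst (_< B) (sym (comp-inc-< p t<l)) z<s
    ... | tri≈ _ refl _ = subst (_< B) (sym (comp-inc-≡ (lead B p) p))
                            (suc-digit (digits cp t<m) (comp-lead≢ p))
    ... | tri> _ _ l<t = subst (_< B) (sym (comp-inc-> p l<t)) (digits cp t<m)

  c-carry : ∀ {m} p → Carry m p → c B (suc (lowValue B m p)) ≡ lead B p
  c-carry {m} p cp = c-suc-lowValue m p (digits cp) (carry≢ p cp)

  mutual
    carry-IsXRootAt : ∀ {m} p → Carry m p → IsXRootAt B (suc m) (suc (lowValue B m p)) p
    carry-IsXRootAt p cp [] = refl
    carry-IsXRootAt {m} p cp (j ∷ a) with <-cmp j (lead B p)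
    ... | tri< j<l _ _ = begin
      is-just (walk B p (j ∷ a))                 ≡⟨ cong is-just (walk-≤ B p a (<⇒≤ j<l)) ⟩
      is-just (walk B (inc j p) a)               ≡⟨ inc-IsXRoot p (overflow-<lead p j<l) a ⟩
      inX B (suc j) 1 a                          ≡⟨ inX-< B (suc m) (suc (lowValue B m p)) a j<c ⟨
      inX B (suc m) (suc (lowValue B m p)) (j ∷ a) ∎
      where j<c = subst (j <_) (sym (c-carry p cp)) j<l
    ... | tri≈ _ refl _ = begin
      is-just (walk B p (lead B p ∷ a))          ≡⟨ cong is-just (walk-≤ B p a ≤-refl) ⟩
      is-just (walk B (lastSon B p) a)           ≡⟨ lastSon-IsXRootAt p cp a ⟩
      inX B (suc m) (nextPos B (suc m) (suc (lowValue B m p))) a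
                                                 ≡⟨ inX-≡ B (suc m) _ a (sym (c-carry p cp)) ⟨
      inX B (suc m) (suc (lowValue B m p)) (lead B p ∷ a) ∎
    ... | tri> _ _ l<j = begin
      is-just (walk B p (j ∷ a))                 ≡⟨ cong is-just (walk-> B p a l<j) ⟩
      false                                      ≡⟨ inX-> B (suc m) (suc (lowValue B m p)) a c<j ⟨
      inX B (suc m) (suc (lowValue B m p)) (j ∷ a) ∎
      where c<j = subst (_< j) (sym (c-carry p cp)) l<j

    inc-IsXRoot : ∀ {j} p → B ≤ suc (comp p j) → IsXRoot B (suc j) (inc j p)
    inc-IsXRoot {j} p ov a = begin
      is-just (walk B (inc j p) a)                    ≡⟨ carry-IsXRootAt (inc j p) (carry-inc p ov) a ⟩
      inX B (suc j) (suc (lowValue B j (inc j p))) a  ≡⟨ cong (λ r → inX B (suc j) (suc r) a)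
                                                           (lowValue-inc-zeros B j p) ⟩
      inX B (suc j) 1 a                               ∎

    lastSon-IsXRootAt : ∀ {m} p → Carry m p →
                        IsXRootAt B (suc m) (nextPos B (suc m) (suc (lowValue B m p))) (lastSon B p)
    lastSon-IsXRootAt {m} p cp a with m≤n⇒m<n∨m≡n (lead-≤ B p (carry≢ p cp))
    ... | inj₁ l<m = begin
      is-just (walk B (lastSon B p) a)                    ≡⟨ carry-IsXRootAt (lastSon B p) cp′ a ⟩
      inX B (suc m) (suc (lowValue B m (lastSon B p))) a  ≡⟨ cong (λ r → inX B (suc m) (suc r) a) lv≡ ⟩
      inX B (suc m) (suc (suc (lowValue B m p))) a        ≡⟨ cong (λ i → inX B (suc m) i a)
                                                               (nextPos-≢ B (suc m) i≢) ⟨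
      inX B (suc m) (nextPos B (suc m) (suc (lowValue B m p))) a ∎
      where
      cp′ = carry-lastSon p cp l<m
      lv≡ = lowValue-lastSon p l<m
      i≢ : suc (lowValue B m p) ≢ B ^ m
      i≢ = <⇒≢ (subst (_< B ^ m) lv≡ (lowValue<B^m m (lastSon B p) (digits cp′)))
    ... | inj₂ refl =
      trans (inc-IsXRoot p (m≤n⇒m≤1+n (overflow cp)) a)
        (cong (λ i → inX B (suc (lead B p)) i a) (sym (nextPos-≡ B _ (lowValue-full _ p ≤-refl))))

theorem4 : (b : ℕ) → 2 ≤ b → (i : ℕ) → 1 ≤ i →
    ((∀ j → comp (v b i) j < b) × value b (v b i) ≡ i ∸ 1)
    × length (sons b (v b i)) ≡ suc (c b i)
    × last (sons b (v b i)) ≡ just (v b (suc i))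
    × (∀ j → 1 ≤ j → j ≤ c b i →
         ∃ λ q → nth (sons b (v b i)) (j ∸ 1) ≡ just q × IsXRoot b j q)
theorem4 (suc (suc d)) (s≤s (s≤s z≤n)) (suc n) (s≤s z≤n) =
  v-canonical n ,
  trans (length-sons B q) (cong suc (sym (c-v n))) ,
  last-sons B q ,
  X-sons
  where
  open Radix d
  q = v B (suc n)
  X-sons : ∀ j → 1 ≤ j → j ≤ c B (suc n) →
           ∃ λ r → nth (sons B q) (j ∸ 1) ≡ just r × IsXRoot B j r
  X-sons (suc j) _ j<c = inc j q , nth-sons B q (<⇒≤ j<l) , inc-IsXRoot {j} q (overflow-<lead q j<l)
    where j<l = subst (suc j ≤_) (c-v n) j<c
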